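{- Let $(a_n)_{n\ge1}$ be the $\{2\}$-LID sequence. Then $a_1=1$, $a_2=2$, $a_3=4$, and for all integers $n\ge 3$, \[ a_{n+1} = a_n + a_{n-2} \quad\text{and}\quad a_{n+1} > \sum_{i=1}^{n-2} a_i. \]
   Context: For a set $S$ of positive integers, the $S$-legal index difference ($S$-LID) sequence $(a_n)_{n\ge 1}$ is defined recursively: for each positive integer $n$, $a_n$ is the smallest positive integer that cannot be written as $\sum_{\ell\in L} a_\ell$ for some set $L \subseteq \{1,\dots,n-1\}$ such that $|i-j|\notin S$ for all $i,j\in L$ (the empty sum is $0$). The $\{2\}$-LID sequence is the case $S=\{2\}$. -}

module Defs where

open import Data.Nat using (ℕ; suc; _+_; _≤_; _<_; ∣_-_∣)
open import Data.List using (List; map)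
open import Data.Nat.ListAction using (sum)
open import Data.List.Membership.Propositional using (_∈_)
open import Data.List.Relation.Unary.Unique.Propositional using (Unique)
open import Data.Product using (Σ; _×_)
open import Relation.Nullary using (¬_)
open import Relation.Binary.PropositionalEquality using (_≡_)

-- A set S of positive integers is given as a predicate on ℕ.
-- Sequences are functions ℕ → ℕ; only indices n ≥ 1 are meaningful (a 0 is junk).

record LegalSet (S : ℕ → Set) (n : ℕ) : Set where
  field
    idx    : List ℕ
    unique : Unique idx
    bounds : ∀ {i} → i ∈ idx → 1 ≤ i × suc i ≤ n
    legal  : ∀ {i j} → i ∈ idx → j ∈ idx → ¬ S ∣ i - j ∣

Representable : (S : ℕ → Set) (a : ℕ → ℕ) (n m : ℕ) → Set
Representable S a n m = Σ (LegalSet S n) λ L → sum (map a (LegalSet.idx L)) ≡ m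

IsLID : (S : ℕ → Set) (a : ℕ → ℕ) → Set
IsLID S a = ∀ n → 1 ≤ n →
  (1 ≤ a n) × ¬ Representable S a n (a n) ×
  (∀ m → 1 ≤ m → m < a n → Representable S a n m)

S₂ : ℕ → Set
S₂ d = d ≡ 2

-- Let b (lid₂ below) be given by b 1 = 1, b 2 = 2, b 3 = 4 and b (n + 1) = b n + b (n - 2). An S-LID
-- sequence is unique, since whether m is representable at step n depends only on the
-- first n - 1 terms; so it suffices to show that b has the defining property. The key
-- estimate is that a {2}-legal set of indices ≤ n has b-weight < b (n + 2): if the top
-- index n is used then n - 2 is not, and if n - 1 is used as well then n - 3 is not, so
-- the rest lies below n - 2 (resp. n - 3) and induction applies. Consequently b (n + 1) is
-- not representable at step n + 1, while every smaller m is: either m ≤ b n, or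
-- m = b n + d with d < b (n - 2), and then n can be added to a representation of d.
module Submission where

open import Defs
open import Data.Nat using (ℕ; zero; suc; _+_; _∸_; _≤_; _<_; z≤n; s≤s; s≤s⁻¹; ∣_-_∣)
open import Data.Nat.Properties
open import Data.Nat.ListAction using (sum)
open import Data.Nat.ListAction.Properties using (sum-++)
open import Data.List using ([]; _∷_; [_]; map; upTo; _++_)
open import Data.List.Properties using (map-cong; map-cong-local; map-∘; map-++; upTo-∷ʳ)
open import Data.List.Membership.Propositional using (_∈_; _∉_; _─_)
open import Data.List.Membership.DecPropositional _≟_ using (_∈?_)
open import Data.List.Relation.Unary.Any using (here; there)
import Data.List.Relation.Unary.All as All
open import Data.List.Relation.Unary.All.Properties using (─⁺)
open import Data.List.Relation.Unary.AllPairs using ([]; _∷_)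
open import Data.List.Relation.Unary.Unique.Propositional using (Unique)
open import Data.Product using (_×_; _,_; proj₁; proj₂; uncurry)
open import Data.Sum using (inj₁; inj₂)
open import Relation.Nullary using (¬_; yes; no; contradiction)
open import Relation.Binary using (tri<; tri≈; tri>)
open import Relation.Binary.PropositionalEquality using (_≡_; _≢_; refl; sym; trans; cong; cong₂; subst; subst₂; ≢-sym; module ≡-Reasoning)
open import Function using (_∘_; case_of_)

module _ {A : Set} {x : A} where

  ─-⊆ : ∀ {xs y} (p : x ∈ xs) → y ∈ xs ─ p → y ∈ xs
  ─-⊆ (here _)  q         = there q
  ─-⊆ (there p) (here e)  = here e
  ─-⊆ (there p) (there q) = there (─-⊆ p q)

  Unique-─ : ∀ {xs} (p : x ∈ xs) → Unique xs → Unique (xs ─ p)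
  Unique-─ (here _)  (_ ∷ u)      = u
  Unique-─ (there p) (y∉xs ∷ u) = ─⁺ p y∉xs ∷ Unique-─ p u

  ∉-─ : ∀ {xs} (p : x ∈ xs) → Unique xs → x ∉ xs ─ p
  ∉-─ (here refl) (x∉xs ∷ _) q         = All.lookup x∉xs q refl
  ∉-─ (there p)   (y∉xs ∷ _) (here refl) = All.lookup y∉xs p refl
  ∉-─ (there p)   (_ ∷ u)    (there q) = ∉-─ p u q

  sum-map-─ : ∀ (f : A → ℕ) {xs} (p : x ∈ xs) → sum (map f xs) ≡ f x + sum (map f (xs ─ p))
  sum-map-─ f (here refl) = refl
  sum-map-─ f {y ∷ xs} (there p) = begin
    f y + sum (map f xs)                 ≡⟨ cong (f y +_) (sum-map-─ f p) ⟩
    f y + (f x + sum (map f (xs ─ p)))   ≡⟨ sym (+-assoc (f y) (f x) _) ⟩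
    (f y + f x) + sum (map f (xs ─ p))   ≡⟨ cong (_+ sum (map f (xs ─ p))) (+-comm (f y) (f x)) ⟩
    (f x + f y) + sum (map f (xs ─ p))   ≡⟨ +-assoc (f x) (f y) _ ⟩
    f x + (f y + sum (map f (xs ─ p)))   ∎
    where open ≡-Reasoning

AgreeBelow : (f g : ℕ → ℕ) → ℕ → Set
AgreeBelow f g n = ∀ {i} → 1 ≤ i → i < n → f i ≡ g i

module _ {S : ℕ → Set} where
  open LegalSet

  weight : ∀ {n} → (ℕ → ℕ) → LegalSet S n → ℕ
  weight f L = sum (map f (idx L))

  ∅ : ∀ {n} → LegalSet S n
  ∅ = record { idx = [] ; unique = [] ; bounds = λ () ; legal = λ () }

  weaken : ∀ {n} → LegalSet S n → LegalSet S (suc n)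
  weaken L = record
    { idx    = idx L
    ; unique = unique L
    ; bounds = λ q → proj₁ (bounds L q) , m≤n⇒m≤1+n (proj₂ (bounds L q))
    ; legal  = legal L }

  representable-weaken : ∀ {f n m} → Representable S f n m → Representable S f (suc n) m
  representable-weaken (L , w≡m) = weaken L , w≡m

  zero∉ : ∀ {n} (L : LegalSet S n) → 0 ∉ idx L
  zero∉ L q with bounds L q
  ... | () , _

  weight₀ : (f : ℕ → ℕ) (L : LegalSet S 0) → weight f L ≡ 0
  weight₀ f L with idx L | bounds L
  ... | []    | _      = refl
  ... | _ ∷ _ | bounds = case proj₂ (bounds (here refl)) of λ ()

  weight₀-+ : ∀ {m} (f : ℕ → ℕ) (L : LegalSet S 0) → m + weight f L ≡ m
  weight₀-+ {m} f L = trans (cong (m +_) (weight₀ f L)) (+-identityʳ m)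

  restrict : ∀ {n} (L : LegalSet S n) → n ∸ 1 ∉ idx L → LegalSet S (n ∸ 1)
  restrict L top∉L = record
    { idx    = idx L
    ; unique = unique L
    ; bounds = λ q → proj₁ (bounds L q) , below-top (proj₂ (bounds L q)) (λ { refl → top∉L q })
    ; legal  = legal L }
    where
    below-top : ∀ {m i} → i < m → i ≢ m ∸ 1 → i < m ∸ 1
    below-top {suc m} i<1+m i≢m = ≤∧≢⇒< (s≤s⁻¹ i<1+m) i≢m

  delete : ∀ {n i} (L : LegalSet S n) → i ∈ idx L → LegalSet S n
  delete L p = record
    { idx    = idx L ─ p
    ; unique = Unique-─ p (unique L)
    ; bounds = bounds L ∘ ─-⊆ p
    ; legal  = λ q r → legal L (─-⊆ p q) (─-⊆ p r) }

  remove : ∀ {n} (L : LegalSet S (suc n)) → n ∈ idx L → LegalSet S n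
  remove L p = restrict (delete L p) (∉-─ p (unique L))

  weight-remove : ∀ {n} (f : ℕ → ℕ) (L : LegalSet S (suc n)) (p : n ∈ idx L) →
                  weight f L ≡ f n + weight f (remove L p)
  weight-remove f L = sum-map-─ f

  insert : ∀ {n} i → ¬ S 0 → (L : LegalSet S n) → 1 ≤ i → n ≤ i →
           (∀ {j} → j ∈ idx L → ¬ S (i ∸ j)) → LegalSet S (suc i)
  insert i ¬S0 L 1≤i n≤i far = record
    { idx    = i ∷ idx L
    ; unique = All.tabulate (λ q → ≢-sym (<⇒≢ (below q))) ∷ unique L
    ; bounds = λ { (here refl) → 1≤i , ≤-refl
                 ; (there q)   → proj₁ (bounds L q) , m≤n⇒m≤1+n (below q) }
    ; legal  = λ { (here refl) (here refl) → ¬S0 ∘ subst S (∣n-n∣≡0 i)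
                 ; (here refl) (there q)   → far q ∘ subst S (distance q)
                 ; (there q)   (here refl) → far q ∘ subst S (trans (∣-∣-comm _ i) (distance q))
                 ; (there q)   (there r)   → legal L q r } }
    where
    below : ∀ {j} → j ∈ idx L → j < i
    below q = ≤-trans (proj₂ (bounds L q)) n≤i
    distance : ∀ {j} → j ∈ idx L → ∣ i - j ∣ ≡ i ∸ j
    distance q = m≤n⇒∣n-m∣≡n∸m (<⇒≤ (below q))

  singleton : ∀ i → ¬ S 0 → 1 ≤ i → LegalSet S (suc i)
  singleton i ¬S0 1≤i = insert i ¬S0 ∅ 1≤i z≤n (λ ())

  representable-transfer : ∀ {f g n m} → AgreeBelow f g n →
                           Representable S f n m → Representable S g n m
  representable-transfer {f} {g} f≡g (L , f[L]≡m) = L , trans (sym f[L]≡g[L]) f[L]≡m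
    where
    f[L]≡g[L] : weight f L ≡ weight g L
    f[L]≡g[L] = cong sum (map-cong-local (All.tabulate (λ q → uncurry f≡g (bounds L q))))

module _ {S : ℕ → Set} where

  IsLID-≮ : ∀ {f g n} → IsLID S f → IsLID S g → 1 ≤ n → AgreeBelow g f n → ¬ f n < g n
  IsLID-≮ f-lid g-lid 1≤n g≡f fn<gn =
    proj₁ (proj₂ (f-lid _ 1≤n))
      (representable-transfer g≡f (proj₂ (proj₂ (g-lid _ 1≤n)) _ (proj₁ (f-lid _ 1≤n)) fn<gn))

  IsLID-agreeBelow : ∀ {f g} → IsLID S f → IsLID S g → ∀ n → AgreeBelow f g n
  IsLID-agreeBelow f-lid g-lid (suc n) 1≤i i<1+n with m≤n⇒m<n∨m≡n (s≤s⁻¹ i<1+n)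
  ... | inj₁ i<n  = IsLID-agreeBelow f-lid g-lid n 1≤i i<n
  ... | inj₂ refl = ≤-antisym (≮⇒≥ (IsLID-≮ g-lid f-lid 1≤i f≡g))
                              (≮⇒≥ (IsLID-≮ f-lid g-lid 1≤i (λ 1≤j j<n → sym (f≡g 1≤j j<n))))
    where
    f≡g : AgreeBelow _ _ n
    f≡g = IsLID-agreeBelow f-lid g-lid n

  IsLID-unique : ∀ {f g} → IsLID S f → IsLID S g → ∀ n → 1 ≤ n → f n ≡ g n
  IsLID-unique f-lid g-lid n 1≤n = IsLID-agreeBelow f-lid g-lid (suc n) 1≤n ≤-refl

-- lid₂ 0 = 2 is a junk value, chosen so that lid₂ 3 = lid₂ 2 + lid₂ 0 also follows the recurrence.
lid₂ : ℕ → ℕ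
lid₂ 0 = 2
lid₂ 1 = 1
lid₂ 2 = 2
lid₂ (suc (suc (suc n))) = lid₂ (suc (suc n)) + lid₂ n

lid₂-pos : ∀ n → 1 ≤ lid₂ n
lid₂-pos 0 = s≤s z≤n
lid₂-pos 1 = s≤s z≤n
lid₂-pos 2 = s≤s z≤n
lid₂-pos (suc (suc (suc n))) = ≤-trans (lid₂-pos (suc (suc n))) (m≤m+n _ _)

lid₂-< : ∀ n → lid₂ (suc n) < lid₂ (suc (suc n))
lid₂-< zero    = ≤-refl
lid₂-< (suc n) = m<m+n _ (lid₂-pos n)

lid₂-≤ : ∀ n → lid₂ (suc n) ≤ lid₂ (suc (suc n))
lid₂-≤ n = <⇒≤ (lid₂-< n)

lid₂-triple : ∀ k → lid₂ (2 + k) + (lid₂ (1 + k) + lid₂ k) ≡ lid₂ (4 + k)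
lid₂-triple k = trans (cong (lid₂ (2 + k) +_) (+-comm (lid₂ (1 + k)) (lid₂ k)))
                      (sym (+-assoc (lid₂ (2 + k)) (lid₂ k) (lid₂ (1 + k))))

open LegalSet

¬S₂0 : ¬ S₂ 0
¬S₂0 ()

partner-∉ : ∀ {m n} (L : LegalSet S₂ m) → suc n ∈ idx L → n ∸ 1 ∉ idx L
partner-∉ {n = zero}  L _ = zero∉ L
partner-∉ {n = suc n} L p q =
  legal L q p (subst (λ k → ∣ n - k ∣ ≡ 2) (+-comm n 2) (∣m-m+n∣≡n n 2))

-- The three ways a legal set L of indices ≤ n + 1 can meet its top: in the last two cases the
-- partners n - 1 of n + 1 and n - 2 of n are missing from L, which is what shrinks the range of L′.
data Shape (f : ℕ → ℕ) : (n : ℕ) → LegalSet S₂ (2 + n) → Set where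
  absent : ∀ {n L} (L′ : LegalSet S₂ (suc n)) →
           weight f L ≡ weight f L′ → Shape f n L
  single : ∀ {n L} (L′ : LegalSet S₂ (n ∸ 1)) →
           weight f L ≡ f (suc n) + weight f L′ → Shape f n L
  pair   : ∀ {n L} (L′ : LegalSet S₂ (n ∸ 2)) → 1 ≤ n →
           weight f L ≡ f (suc n) + (f n + weight f L′) → Shape f n L

shape-top : ∀ f {n} (L : LegalSet S₂ (2 + n)) → suc n ∈ idx L → Shape f n L
shape-top f {n} L top∈L with n ∈? idx (remove L top∈L)
shape-top f {n} L top∈L | no n∉R =
  single (restrict (restrict (remove L top∈L) n∉R) (partner-∉ L top∈L ∘ ─-⊆ top∈L))
         (weight-remove f L top∈L)
shape-top f {zero} L top∈L | yes 0∈R = contradiction 0∈R (zero∉ (remove L top∈L))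
shape-top f {suc k} L top∈L | yes k+1∈R = pair (restrict (restrict R′ k∉R′) k∸1∉R′) (s≤s z≤n) (begin
  weight f L                                    ≡⟨ weight-remove f L top∈L ⟩
  f (2 + k) + weight f R                        ≡⟨ cong (f (2 + k) +_) (weight-remove f R k+1∈R) ⟩
  f (2 + k) + (f (suc k) + weight f R′)         ∎)
  where
  open ≡-Reasoning
  R : LegalSet S₂ (2 + k)
  R = remove L top∈L
  R′ : LegalSet S₂ (suc k)
  R′ = remove R k+1∈R
  R′⊆L : ∀ {i} → i ∈ idx R′ → i ∈ idx L
  R′⊆L = ─-⊆ top∈L ∘ ─-⊆ k+1∈R
  k∉R′ : k ∉ idx R′
  k∉R′ = partner-∉ L top∈L ∘ R′⊆L
  k∸1∉R′ : k ∸ 1 ∉ idx (restrict R′ k∉R′)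
  k∸1∉R′ = partner-∉ L (─-⊆ top∈L k+1∈R) ∘ R′⊆L

shape : ∀ f {n} (L : LegalSet S₂ (2 + n)) → Shape f n L
shape f {n} L with suc n ∈? idx L
... | no  top∉L = absent (restrict L top∉L) refl
... | yes top∈L = shape-top f L top∈L

mutual
  weight-<-lid₂ : ∀ {n} (L : LegalSet S₂ (suc n)) → weight lid₂ L < lid₂ (2 + n)
  weight-<-lid₂ {0} L = subst (_< lid₂ 2) (sym (weight₀ lid₂ (restrict L (zero∉ L)))) (lid₂-pos 2)
  weight-<-lid₂ {suc n} L with shape lid₂ L
  ... | absent L′ eq = begin-strict
    weight lid₂ L                 ≡⟨ eq ⟩
    weight lid₂ L′                <⟨ weight-<-lid₂ L′ ⟩
    lid₂ (2 + n)                  ≤⟨ m≤m+n _ _ ⟩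
    lid₂ (3 + n)                  ∎
    where open ≤-Reasoning
  ... | single L′ eq = begin-strict
    weight lid₂ L                 ≡⟨ eq ⟩
    lid₂ (1 + n) + weight lid₂ L′ <⟨ +-mono-≤-< (lid₂-≤ n) (weight-<-lid₂∸1 {n} L′) ⟩
    lid₂ (3 + n)                  ∎
    where open ≤-Reasoning
  weight-<-lid₂ {suc (suc k)} L | pair L′ _ eq = begin-strict
    weight lid₂ L                                   ≡⟨ eq ⟩
    lid₂ (2 + k) + (lid₂ (1 + k) + weight lid₂ L′)  <⟨ +-monoʳ-< (lid₂ (2 + k)) (+-monoʳ-< (lid₂ (1 + k)) rest<) ⟩
    lid₂ (2 + k) + (lid₂ (1 + k) + lid₂ k)          ≡⟨ lid₂-triple k ⟩
    lid₂ (4 + k)                                    ∎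
    where
    open ≤-Reasoning
    rest< : weight lid₂ L′ < lid₂ k
    rest< = weight-<-lid₂∸1 {k} L′

  weight-<-lid₂∸1 : ∀ {n} (L : LegalSet S₂ (n ∸ 1)) → weight lid₂ L < lid₂ n
  weight-<-lid₂∸1 {0}           L = subst (_< lid₂ 0) (sym (weight₀ lid₂ L)) (lid₂-pos 0)
  weight-<-lid₂∸1 {1}           L = subst (_< lid₂ 1) (sym (weight₀ lid₂ L)) (lid₂-pos 1)
  weight-<-lid₂∸1 {suc (suc n)} L = weight-<-lid₂ L

insert-far : ∀ {t} (L : LegalSet S₂ (suc t)) → LegalSet S₂ (4 + t)
insert-far {t} L = insert (3 + t) ¬S₂0 L (s≤s z≤n) (m≤n+m _ 2) far
  where
  far : ∀ {j} → j ∈ idx L → ¬ S₂ (3 + t ∸ j)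
  far q = (λ ()) ∘ trans (sym (+-∸-assoc 3 (s≤s⁻¹ (proj₂ (bounds L q)))))

lid₂-unrepresentable : ∀ n → ¬ Representable S₂ lid₂ (suc n) (lid₂ (suc n))
lid₂-unrepresentable 0 (L , w≡1) = 0≢1+n (trans (sym (weight₀ lid₂ (restrict L (zero∉ L)))) w≡1)
lid₂-unrepresentable (suc n) (L , w≡) with shape lid₂ L
... | absent L′ e = <⇒≢ (weight-<-lid₂ L′) (trans (sym e) w≡)
lid₂-unrepresentable 1 (L , w≡) | single L′ e =
  contradiction (trans (sym (trans e (weight₀-+ lid₂ L′))) w≡) λ ()
lid₂-unrepresentable 2 (L , w≡) | single L′ e =
  contradiction (trans (sym (trans e (weight₀-+ lid₂ L′))) w≡) λ ()
lid₂-unrepresentable (suc (suc (suc t))) (L , w≡) | single L′ e =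
  lid₂-unrepresentable t (L′ , +-cancelˡ-≡ (lid₂ (3 + t)) _ _ (trans (sym e) w≡))
lid₂-unrepresentable 2 (L , w≡) | pair L′ _ e =
  contradiction (trans (sym (trans e (cong (lid₂ 2 +_) (weight₀-+ lid₂ L′)))) w≡) λ ()
lid₂-unrepresentable (suc (suc (suc t))) (L , w≡) | pair L′ _ e =
  >⇒≢ (+-monoʳ-< (lid₂ (3 + t)) (<-≤-trans (lid₂-< t) (m≤m+n _ _))) (trans (sym e) w≡)

mutual
  lid₂-complete : ∀ n m → 1 ≤ m → m < lid₂ (suc n) → Representable S₂ lid₂ (suc n) m
  lid₂-complete 0 m 1≤m m<1 = contradiction 1≤m (<⇒≱ m<1)
  lid₂-complete (suc n) m 1≤m m<b with <-cmp m (lid₂ (suc n))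
  ... | tri< m<b′ _ _ = representable-weaken (lid₂-complete n m 1≤m m<b′)
  ... | tri≈ _ refl _ = singleton (suc n) ¬S₂0 (s≤s z≤n) , +-identityʳ _
  ... | tri> _ _ b′<m = lid₂-complete-above n m b′<m m<b

  lid₂-complete-above : ∀ n m → lid₂ (suc n) < m → m < lid₂ (2 + n) → Representable S₂ lid₂ (2 + n) m
  lid₂-complete-above 0 m 1<m m<2 = contradiction 1<m (<⇒≱ m<2)
  lid₂-complete-above 1 m 2<m m<4 = subst (Representable S₂ lid₂ 3) (≤-antisym 2<m (s≤s⁻¹ m<4)) rep₃
    where
    rep₃ : Representable S₂ lid₂ 3 3
    rep₃ = insert 2 ¬S₂0 (singleton 1 ¬S₂0 ≤-refl) (s≤s z≤n) ≤-refl (λ { (here refl) () }) , refl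
  lid₂-complete-above (suc (suc t)) m b<m m<b+c =
    let L , w≡d = lid₂-complete t d (m<n⇒0<n∸m b<m) d<c
    in  insert-far L , trans (cong (lid₂ (3 + t) +_) w≡d) b+d≡m
    where
    d : ℕ
    d = m ∸ lid₂ (3 + t)
    b+d≡m : lid₂ (3 + t) + d ≡ m
    b+d≡m = m+[n∸m]≡n (<⇒≤ b<m)
    d<c : d < lid₂ (suc t)
    d<c = +-cancelˡ-< (lid₂ (3 + t)) _ _ (subst (_< lid₂ (4 + t)) (sym b+d≡m) m<b+c)

lid₂-isLID : IsLID S₂ lid₂
lid₂-isLID (suc n) _ = lid₂-pos (suc n) , lid₂-unrepresentable n , lid₂-complete n

partialSum : (ℕ → ℕ) → ℕ → ℕ
partialSum f k = sum (map f (map suc (upTo k)))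

partialSum-suc : ∀ f k → partialSum f (suc k) ≡ partialSum f k + f (suc k)
partialSum-suc f k = begin
  sum (map f (map suc (upTo (suc k))))             ≡⟨ cong (sum ∘ map f ∘ map suc) (sym (upTo-∷ʳ k)) ⟩
  sum (map f (map suc (upTo k ++ [ k ])))          ≡⟨ cong (sum ∘ map f) (map-++ suc (upTo k) [ k ]) ⟩
  sum (map f (map suc (upTo k) ++ [ suc k ]))      ≡⟨ cong sum (map-++ f (map suc (upTo k)) [ suc k ]) ⟩
  sum (map f (map suc (upTo k)) ++ [ f (suc k) ])  ≡⟨ sum-++ (map f (map suc (upTo k))) [ f (suc k) ] ⟩
  partialSum f k + (f (suc k) + 0)                 ≡⟨ cong (partialSum f k +_) (+-identityʳ (f (suc k))) ⟩
  partialSum f k + f (suc k)                       ∎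
  where open ≡-Reasoning

partialSum-cong : ∀ {f g} → (∀ i → f (suc i) ≡ g (suc i)) → ∀ k → partialSum f k ≡ partialSum g k
partialSum-cong {f} {g} f≡g k = begin
  sum (map f (map suc (upTo k)))  ≡⟨ cong sum (sym (map-∘ (upTo k))) ⟩
  sum (map (f ∘ suc) (upTo k))    ≡⟨ cong sum (map-cong f≡g (upTo k)) ⟩
  sum (map (g ∘ suc) (upTo k))    ≡⟨ cong sum (map-∘ (upTo k)) ⟩
  sum (map g (map suc (upTo k)))  ∎
  where open ≡-Reasoning

partialSum-<-lid₂ : ∀ k → partialSum lid₂ k < lid₂ (3 + k)
partialSum-<-lid₂ zero    = lid₂-pos 3
partialSum-<-lid₂ (suc k) = begin-strict
  partialSum lid₂ (suc k)             ≡⟨ partialSum-suc lid₂ k ⟩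
  partialSum lid₂ k + lid₂ (suc k)    <⟨ +-monoˡ-< (lid₂ (suc k)) (partialSum-<-lid₂ k) ⟩
  lid₂ (4 + k)                        ∎
  where open ≤-Reasoning

proposition2p3 : (a : ℕ → ℕ) → IsLID S₂ a →
    (a 1 ≡ 1) × (a 2 ≡ 2) × (a 3 ≡ 4) ×
    (∀ n → 3 ≤ n →
      (a (suc n) ≡ a n + a (n ∸ 2)) ×
      (sum (map a (map suc (upTo (n ∸ 2)))) < a (suc n)))
proposition2p3 a a-lid = a≡lid₂ 0 , a≡lid₂ 1 , a≡lid₂ 2 , recurrence
  where
  a≡lid₂ : ∀ n → a (suc n) ≡ lid₂ (suc n)
  a≡lid₂ n = IsLID-unique a-lid lid₂-isLID (suc n) (s≤s z≤n)

  recurrence : ∀ n → 3 ≤ n →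
    (a (suc n) ≡ a n + a (n ∸ 2)) × (sum (map a (map suc (upTo (n ∸ 2)))) < a (suc n))
  recurrence 1 (s≤s ())
  recurrence 2 (s≤s (s≤s ()))
  recurrence (suc (suc (suc t))) _ =
      trans (a≡lid₂ (3 + t)) (sym (cong₂ _+_ (a≡lid₂ (2 + t)) (a≡lid₂ t)))
    , subst₂ _<_ (partialSum-cong {lid₂} {a} (sym ∘ a≡lid₂) (suc t)) (sym (a≡lid₂ (3 + t)))
                 (partialSum-<-lid₂ (suc t))
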